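{- Let $I$ be an instance of SPA-ST and let $M$ be a matching in $I$. Then $M$ is super-stable in $I$ if and only if $M$ is stable in every instance of SPA-S obtained from $I$ by breaking the ties in some way.
   Context: An instance $I$ of SPA-ST consists of a set $\mathcal{S}=\{s_1,\dots,s_{n_1}\}$ of students, a set $\mathcal{P}=\{p_1,\dots,p_{n_2}\}$ of projects and a set $\mathcal{L}=\{l_1,\dots,l_{n_3}\}$ of lecturers. Each student $s_i$ has a set $A_i\subseteq\mathcal{P}$ of acceptable projects and a preference list ranking $A_i$ as a strict ranking of ties (a tie is a set of equally preferred entries; a non-tied entry is a tie of length one). Each lecturer $l_k$ offers a non-empty set $P_k$ of projects, where $P_1,\dots,P_{n_3}$ partition $\mathcal{P}$; $l_k$ has a capacity $d_k\in\mathbb{Z}^+$ and a preference list $\mathcal{L}_k$ ranking, as a strict ranking of ties, exactly those students who find at least one project in $P_k$ acceptable. Each project $p_j$ has capacity $c_j\in\mathbb{Z}^+$, and $\max\{c_j:p_j\in P_k\}\le d_k\le\sum\{c_j:p_j\in P_k\}$. SPA-S is the special case in which all preference lists are strict orders. An assignment is a set $M\subseteq\mathcal{S}\times\mathcal{P}$ of acceptable pairs; $M(s_i)$, $M(p_j)$, $M(l_k)$ denote the projects assigned to $s_i$, the students assigned to $p_j$, and the students assigned to projects of $l_k$. A matching is an assignment in which each student has at most one project, $|M(p_j)|\le c_j$ and $|M(l_k)|\le d_k$. A project (lecturer) is undersubscribed/full according as it has fewer than / exactly its capacity many assignees. In what follows $l_k$ denotes the lecturer offering $p_j$. A matching $M$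 in an SPA-S instance is stable if there is no acceptable pair $(s_i,p_j)\notin M$ such that (a) $s_i$ is unassigned or prefers $p_j$ to $M(s_i)$, and (b) either (i) $p_j$ and $l_k$ are both undersubscribed, or (ii) $p_j$ is undersubscribed, $l_k$ is full, and either $s_i\in M(l_k)$ or $l_k$ prefers $s_i$ to the worst student in $M(l_k)$, or (iii) $p_j$ is full and $l_k$ prefers $s_i$ to the worst student in $M(p_j)$. A matching $M$ in an SPA-ST instance is super-stable if there is no acceptable pair $(s_i,p_j)\notin M$ such that (a) $s_i$ is unassigned, or prefers $p_j$ to $M(s_i)$ or is indifferent between them, and (b) either (i) $p_j$ and $l_k$ are both undersubscribed, or (ii) $p_j$ is undersubscribed, $l_k$ is full, and either $s_i\in M(l_k)$ or $l_k$ prefers $s_i$ to a worst student in $M(l_k)$ or is indifferent between them, or (iii) $p_j$ is full and $l_k$ prefers $s_i$ to a worst student in $M(p_j)$ or is indifferent between them. An SPA-S instance obtained from $I$ by breaking the ties is one with the same students, projects, lecturers, capacities and acceptable sets, in which each preference list is a strict order refining the corresponding list of $I$ (i.e., strict preferences of $I$ are kept and entries within each tie are ordered in some way). -}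

module Defs where

open import Data.Nat using (ℕ; _≤_; _<_)
open import Data.Bool using (Bool; T)
open import Data.Fin using (Fin)
open import Data.List using (List; length; filter; map)
open import Data.Nat.ListAction using (sum)
open import Data.Empty using (⊥)
open import Data.Fin using () renaming (_≟_ to _≟F_)
open import Data.List.Membership.Propositional using (_∈_)
import Data.Maybe as Maybe
open Maybe using (Maybe; just; nothing)
open import Data.Maybe.Properties using (≡-dec)
open import Data.Product using (Σ; ∃; ∃-syntax; _×_; _,_)
open import Data.Sum using (_⊎_)
open import Relation.Binary.PropositionalEquality using (_≡_; _≢_)
open import Data.List using () renaming (allFin to allFinL)

-- Students are Fin n₁, projects Fin n₂, lecturers Fin n₃.
-- A preference list that is a strict ranking of ties is encoded by a
-- rank function into ℕ: smaller rank = more preferred, equal rank = tied.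
-- srank s p is only meaningful for acceptable p; lrank l s is only
-- meaningful for students s in l's list (those finding some project of
-- l acceptable).

record Instance (n₁ n₂ n₃ : ℕ) : Set where
  field
    acc     : Fin n₁ → Fin n₂ → Bool
    srank   : Fin n₁ → Fin n₂ → ℕ
    offer   : Fin n₂ → Fin n₃                 -- lecturer offering p (partition P_1..P_n₃)
    lrank   : Fin n₃ → Fin n₁ → ℕ
    pcap    : Fin n₂ → ℕ
    lcap    : Fin n₃ → ℕ
    offers-nonempty : ∀ l → ∃[ p ] offer p ≡ l
    pcap-pos : ∀ p → 1 ≤ pcap p
    lcap-pos : ∀ l → 1 ≤ lcap l
    pcap≤lcap : ∀ p → pcap p ≤ lcap (offer p)
    lcap≤sum : ∀ l → lcap l ≤ sum (map pcap (filter (λ p → offer p ≟F l) (allFinL n₂)))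

module _ {n₁ n₂ n₃ : ℕ} (I : Instance n₁ n₂ n₃) where
  open Instance I

  Acceptable : Fin n₁ → Fin n₂ → Set
  Acceptable s p = T (acc s p)

  InList : Fin n₃ → Fin n₁ → Set
  InList l s = ∃[ p ] (offer p ≡ l × Acceptable s p)

  IsStrict : Set
  IsStrict =
    (∀ s p q → Acceptable s p → Acceptable s q → p ≢ q → srank s p ≢ srank s q) ×
    (∀ l s s' → InList l s → InList l s' → s ≢ s' → lrank l s ≢ lrank l s')

Assign : ℕ → ℕ → Set
Assign n₁ n₂ = Fin n₁ → Maybe (Fin n₂)

module _ {n₁ n₂ n₃ : ℕ} (I : Instance n₁ n₂ n₃) (M : Assign n₁ n₂) where
  open Instance I

  assigneesP : Fin n₂ → List (Fin n₁)
  assigneesP p = filter (λ s → ≡-dec _≟F_ (M s) (just p)) (allFinL n₁)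

  assigneesL : Fin n₃ → List (Fin n₁)
  assigneesL l = filter (λ s → ≡-dec _≟F_ (Maybe.map offer (M s)) (just l)) (allFinL n₁)

  IsMatching : Set
  IsMatching =
    (∀ s p → M s ≡ just p → Acceptable I s p) ×
    (∀ p → length (assigneesP p) ≤ pcap p) ×
    (∀ l → length (assigneesL l) ≤ lcap l)

  UndersubP : Fin n₂ → Set
  UndersubP p = length (assigneesP p) < pcap p
  FullP : Fin n₂ → Set
  FullP p = length (assigneesP p) ≡ pcap p
  UndersubL : Fin n₃ → Set
  UndersubL l = length (assigneesL l) < lcap l
  FullL : Fin n₃ → Set
  FullL l = length (assigneesL l) ≡ lcap l

  IsWorst : Fin n₃ → List (Fin n₁) → Fin n₁ → Set
  IsWorst l xs w = w ∈ xs × (∀ x → x ∈ xs → lrank l x ≤ lrank l w)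

  -- Blocking pair, parametrised by the comparison R on ranks:
  -- R = _<_  : "prefers"            (stability, SPA-S)
  -- R = _≤_  : "prefers or indifferent" (super-stability, SPA-ST)
  Blocking : (ℕ → ℕ → Set) → Fin n₁ → Fin n₂ → Set
  Blocking R s p =
    Acceptable I s p × M s ≢ just p ×
    (M s ≡ nothing ⊎ ∃[ q ] (M s ≡ just q × R (srank s p) (srank s q))) ×
    ( (UndersubP p × UndersubL (offer p))
    ⊎ (UndersubP p × FullL (offer p) ×
        (s ∈ assigneesL (offer p)
         ⊎ ∃[ w ] (IsWorst (offer p) (assigneesL (offer p)) w
                   × R (lrank (offer p) s) (lrank (offer p) w))))
    ⊎ (FullP p × ∃[ w ] (IsWorst (offer p) (assigneesP p) w
                   × R (lrank (offer p) s) (lrank (offer p) w))))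

  Stable : Set
  Stable = ∀ s p → Blocking _<_ s p → ⊥

  SuperStable : Set
  SuperStable = ∀ s p → Blocking _≤_ s p → ⊥

BreaksTies : {n₁ n₂ n₃ : ℕ} → Instance n₁ n₂ n₃ → Instance n₁ n₂ n₃ → Set
BreaksTies {n₁} {n₂} {n₃} I J =
  (∀ s p → I.acc s p ≡ J.acc s p) ×
  (∀ p → I.offer p ≡ J.offer p) ×
  (∀ p → I.pcap p ≡ J.pcap p) ×
  (∀ l → I.lcap l ≡ J.lcap l) ×
  IsStrict J ×
  (∀ s p q → Acceptable I s p → Acceptable I s q →
     I.srank s p < I.srank s q → J.srank s p < J.srank s q) ×
  (∀ l s s' → InList I l s → InList I l s' →
     I.lrank l s < I.lrank l s' → J.lrank l s < J.lrank l s')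
  where
    module I = Instance I
    module J = Instance J

module Submission where

-- Both directions are instances of one transfer principle: a blocking pair
-- of one instance is a blocking pair of another instance on the same frame
-- (acceptable pairs, lecturers, capacities) as soon as every student-side
-- and lecturer-side rank comparison that the pair relies on is carried over.
-- The lecturer side compares with a *worst* assignee, and a worst element
-- for one ranking need not be worst for the other; this is repaired by
-- 'worst-above': if some member of a list satisfies an upward-closed
-- condition on its rank, then so does a worst member.
--
--   (⇒) If J breaks the ties of I then J-strict comparisons reflect to
--       I-weak ones ('refinement-reflects'), so a J-blocking pair for
--       stability is an I-blocking pair for super-stability.
--   (⇐) Given an I-blocking pair (s, p) for super-stability, break every
--       tie of I in favour of p (student lists) and of s (lecturer lists),
--       by refining each rank with an injective key ('refine', 'favour').
--       In this tie-breaking the pair blocks M for stability.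

open import Defs
open import Data.Nat using (ℕ)
open import Function.Bundles using (_⇔_)

open import Data.Nat using (suc; _+_; _*_; _≤_; _<_; z≤n; s≤s)
open import Data.Nat.Properties
  using (≤-trans; <-≤-trans; <-asym; ≮⇒≥; +-cancelʳ-≡; +-monoˡ-<; +-mono-<-≤;
         *-monoˡ-≤; m≤n+m; <-irrefl; <-cmp; module ≤-Reasoning)
open import Data.Bool using (T)
open import Data.Fin using (Fin; zero; suc; toℕ) renaming (_≟_ to _≟F_)
open import Data.Fin.Properties using (toℕ-injective; toℕ<n)
open import Data.List using (List; length; allFin)
open import Data.List.Properties using (filter-≐)
open import Data.List.Membership.Propositional using (_∈_)
open import Data.List.Membership.Propositional.Properties using (∈-filter⁻; ∈-filter⁺; ∈-allFin)
import Data.List.Relation.Unary.All as All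
open import Data.List.Extrema.Nat using (argmax; argmax-sel; f[xs]≤f[argmax]; f[⊥]≤f[argmax])
import Data.Maybe as Maybe
open Maybe using (just; nothing)
open import Data.Maybe.Properties using (≡-dec; just-injective)
open import Data.Product using (∃-syntax; _×_; _,_; proj₁; proj₂)
open import Data.Sum using (_⊎_; inj₁; inj₂)
open import Data.Empty using (⊥-elim)
open import Function.Bundles using (mk⇔)
open import Relation.Nullary using (yes; no)
open import Relation.Binary.Definitions using (tri<; tri≈; tri>)
open import Relation.Binary.PropositionalEquality
  using (_≡_; _≢_; refl; sym; trans; cong; subst; subst₂)

Worst : {A : Set} → (A → ℕ) → List A → A → Set
Worst r xs w = w ∈ xs × (∀ x → x ∈ xs → r x ≤ r w)

UpClosed : (ℕ → Set) → Set
UpClosed P = ∀ {m n} → P m → m ≤ n → P n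

worst-above : {A : Set} (r : A → ℕ) {P : ℕ → Set} {xs : List A} {a : A} →
              UpClosed P → a ∈ xs → P (r a) → ∃[ w ] (Worst r xs w × P (r w))
worst-above r {xs = xs} {a} up a∈xs Pa =
  argmax r a xs , (argmax∈xs (argmax-sel r a xs) , below-argmax) ,
  up Pa (f[⊥]≤f[argmax] {f = r} a xs)
  where
    argmax∈xs : argmax r a xs ≡ a ⊎ argmax r a xs ∈ xs → argmax r a xs ∈ xs
    argmax∈xs (inj₁ argmax≡a) = subst (_∈ xs) (sym argmax≡a) a∈xs
    argmax∈xs (inj₂ ∈xs)      = ∈xs

    below-argmax : ∀ x → x ∈ xs → r x ≤ r (argmax r a xs)
    below-argmax x x∈xs = All.lookup (f[xs]≤f[argmax] {f = r} a xs) x∈xs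

refinement-reflects : {A : Set} {D : A → Set} (r r' : A → ℕ) →
  (∀ x y → D x → D y → r x < r y → r' x < r' y) →
  ∀ {x y} → D x → D y → r' x < r' y → r x ≤ r y
refinement-reflects r r' refines {x} {y} Dx Dy r'x<r'y =
  ≮⇒≥ (λ ry<rx → <-asym r'x<r'y (refines y x Dy Dx ry<rx))

-- The ranking r with its ties broken by the key k: lexicographic in (r, k).
refine : {A : Set} {K : ℕ} → (A → ℕ) → (A → Fin K) → A → ℕ
refine {K = K} r k x = toℕ (k x) + r x * K

module _ {A : Set} {K : ℕ} (r : A → ℕ) (k : A → Fin K) where

  refine-< : ∀ {x y} → r x < r y → refine r k x < refine r k y
  refine-< {x} {y} rx<ry = begin-strict
    toℕ (k x) + r x * K <⟨ +-monoˡ-< (r x * K) (toℕ<n (k x)) ⟩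
    K + r x * K         ≤⟨ *-monoˡ-≤ K rx<ry ⟩
    r y * K             ≤⟨ m≤n+m (r y * K) (toℕ (k y)) ⟩
    toℕ (k y) + r y * K ∎
    where open ≤-Reasoning

  refine-key : ∀ {x y} → r x ≤ r y → toℕ (k x) < toℕ (k y) → refine r k x < refine r k y
  refine-key rx≤ry kx<ky = +-mono-<-≤ kx<ky (*-monoˡ-≤ K rx≤ry)

  refine-injective : (∀ {x y} → k x ≡ k y → x ≡ y) →
                     ∀ {x y} → refine r k x ≡ refine r k y → x ≡ y
  refine-injective k-inj {x} {y} eq with <-cmp (r x) (r y)
  ... | tri< rx<ry _ _ = ⊥-elim (<-irrefl eq (refine-< rx<ry))
  ... | tri> _ _ ry<rx = ⊥-elim (<-irrefl (sym eq) (refine-< ry<rx))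
  ... | tri≈ _ rx≡ry _ =
    k-inj (toℕ-injective (+-cancelʳ-≡ (r x * K) (toℕ (k x)) (toℕ (k y))
             (trans eq (cong (λ n → toℕ (k y) + n * K) (sym rx≡ry)))))

favour : {n : ℕ} → Fin n → Fin n → Fin (suc n)
favour x y with y ≟F x
... | yes _ = zero
... | no _  = suc y

favour-injective : {n : ℕ} (x : Fin n) {y z : Fin n} → favour x y ≡ favour x z → y ≡ z
favour-injective x {y} {z} eq with y ≟F x | z ≟F x
favour-injective x {y} {z} eq    | yes y≡x | yes z≡x = trans y≡x (sym z≡x)
favour-injective x {y} {z} ()    | yes _   | no _
favour-injective x {y} {z} ()    | no _    | yes _
favour-injective x {y} {z} refl  | no _    | no _    = refl

favour-first : {n : ℕ} (x : Fin n) {y : Fin n} → y ≢ x → toℕ (favour x x) < toℕ (favour x y)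
favour-first x {y} y≢x with x ≟F x | y ≟F x
... | no x≢x | _       = ⊥-elim (x≢x refl)
... | yes _  | yes y≡x = ⊥-elim (y≢x y≡x)
... | yes _  | no _    = s≤s z≤n

module _ {n₁ n₂ n₃ : ℕ} (I : Instance n₁ n₂ n₃) (M : Assign n₁ n₂) where
  open Instance I

  StudentSide : (ℕ → ℕ → Set) → Fin n₁ → Fin n₂ → Set
  StudentSide R s p = M s ≡ nothing ⊎ ∃[ q ] (M s ≡ just q × R (srank s p) (srank s q))

  LecturerSideAt : (ℕ → ℕ → Set) → Fin n₁ → Fin n₂ → Fin n₃ → Set
  LecturerSideAt R s p l =
      (UndersubP I M p × UndersubL I M l)
    ⊎ (UndersubP I M p × FullL I M l ×
        (s ∈ assigneesL I M l
         ⊎ ∃[ w ] (Worst (lrank l) (assigneesL I M l) w × R (lrank l s) (lrank l w))))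
    ⊎ (FullP I M p × ∃[ w ] (Worst (lrank l) (assigneesP I M p) w × R (lrank l s) (lrank l w)))

  -- 'Blocking I M R s p' unfolds to
  --   Acceptable I s p × M s ≢ just p × StudentSide R s p × LecturerSideAt R s p (offer p).

  assigneesP⁻ : ∀ {w p} → w ∈ assigneesP I M p → M w ≡ just p
  assigneesP⁻ {p = p} w∈ =
    proj₂ (∈-filter⁻ (λ s → ≡-dec _≟F_ (M s) (just p)) {xs = allFin n₁} w∈)

  assigneesL⁺ : ∀ {w q} → M w ≡ just q → w ∈ assigneesL I M (offer q)
  assigneesL⁺ {w} {q} Mw≡q =
    ∈-filter⁺ (λ s → ≡-dec _≟F_ (Maybe.map offer (M s)) (just (offer q)))
              (∈-allFin w) (cong (Maybe.map offer) Mw≡q)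

  assigneesL⁻ : ∀ {w l} → w ∈ assigneesL I M l → ∃[ q ] (M w ≡ just q × offer q ≡ l)
  assigneesL⁻ {w} {l} w∈ =
    offered (proj₂ (∈-filter⁻ (λ s → ≡-dec _≟F_ (Maybe.map offer (M s)) (just l)) {xs = allFin n₁} w∈))
    where
      offered : ∀ {m} → Maybe.map offer m ≡ just l → ∃[ q ] (m ≡ just q × offer q ≡ l)
      offered {just q} e = q , refl , just-injective e

  assigneesP⊆assigneesL : ∀ {w p} → w ∈ assigneesP I M p → w ∈ assigneesL I M (offer p)
  assigneesP⊆assigneesL w∈ = assigneesL⁺ (assigneesP⁻ w∈)

record SameFrame {n₁ n₂ n₃ : ℕ} (I₁ I₂ : Instance n₁ n₂ n₃) : Set where
  constructor same-frame
  private
    module I₁ = Instance I₁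
    module I₂ = Instance I₂
  field
    acc≡   : ∀ s p → I₁.acc s p ≡ I₂.acc s p
    offer≡ : ∀ p → I₁.offer p ≡ I₂.offer p
    pcap≡  : ∀ p → I₁.pcap p ≡ I₂.pcap p
    lcap≡  : ∀ l → I₁.lcap l ≡ I₂.lcap l

module Transfer {n₁ n₂ n₃ : ℕ} {I₁ I₂ : Instance n₁ n₂ n₃} (frame : SameFrame I₁ I₂)
                (M : Assign n₁ n₂) where
  private
    module I₁ = Instance I₁
    module I₂ = Instance I₂
  open SameFrame frame

  assigneesL≡ : ∀ l → assigneesL I₁ M l ≡ assigneesL I₂ M l
  assigneesL≡ l =
    filter-≐ (λ s → ≡-dec _≟F_ (Maybe.map I₁.offer (M s)) (just l))
             (λ s → ≡-dec _≟F_ (Maybe.map I₂.offer (M s)) (just l))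
             ((λ {s} e → trans (sym (map-offer≡ s)) e) , (λ {s} e → trans (map-offer≡ s) e))
             (allFin n₁)
    where
      map-offer≡ : ∀ s → Maybe.map I₁.offer (M s) ≡ Maybe.map I₂.offer (M s)
      map-offer≡ s with M s
      ... | nothing = refl
      ... | just q  = cong just (offer≡ q)

  StudentComparisons : (R₁ R₂ : ℕ → ℕ → Set) → Fin n₁ → Fin n₂ → Set
  StudentComparisons R₁ R₂ s p =
    ∀ q → M s ≡ just q → R₁ (I₁.srank s p) (I₁.srank s q) → R₂ (I₂.srank s p) (I₂.srank s q)

  LecturerComparisons : (R₁ R₂ : ℕ → ℕ → Set) → Fin n₁ → Fin n₂ → Set
  LecturerComparisons R₁ R₂ s p =
    ∀ w → w ∈ assigneesL I₁ M l → w ≢ s →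
    R₁ (I₁.lrank l s) (I₁.lrank l w) → R₂ (I₂.lrank l s) (I₂.lrank l w)
    where l = I₁.offer p

  lecturer-side : ∀ {R₁ R₂ : ℕ → ℕ → Set} {s p} → M s ≢ just p →
    (∀ {a} → UpClosed (R₂ a)) →
    LecturerComparisons R₁ R₂ s p →
    LecturerSideAt I₁ M R₁ s p (I₁.offer p) → LecturerSideAt I₂ M R₂ s p (I₁.offer p)
  lecturer-side {R₁} {R₂} {s} {p} unassigned up compare = transfer
    where
      l : Fin n₃
      l = I₁.offer p

      some-worst : ∀ {xs} → (∀ w → w ∈ xs → w ∈ assigneesL I₁ M l) →
        ∀ w → w ∈ xs → w ≢ s → R₁ (I₁.lrank l s) (I₁.lrank l w) →
        ∃[ w' ] (Worst (I₂.lrank l) xs w' × R₂ (I₂.lrank l s) (I₂.lrank l w'))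
      some-worst ⊆L w w∈ w≢s Rw = worst-above (I₂.lrank l) up w∈ (compare w (⊆L w w∈) w≢s Rw)

      transfer : LecturerSideAt I₁ M R₁ s p l → LecturerSideAt I₂ M R₂ s p l
      transfer (inj₁ (p-under , l-under)) =
        inj₁ (subst (_ <_) (pcap≡ p) p-under ,
              subst₂ _<_ (cong length (assigneesL≡ l)) (lcap≡ l) l-under)
      transfer (inj₂ (inj₁ (p-under , l-full , l-side))) =
        inj₂ (inj₁ (subst (_ <_) (pcap≡ p) p-under ,
                    subst₂ _≡_ (cong length (assigneesL≡ l)) (lcap≡ l) l-full ,
                    member-or-beaten l-side))
        where
          member-or-beaten : s ∈ assigneesL I₁ M l
                    ⊎ ∃[ w ] (Worst (I₁.lrank l) (assigneesL I₁ M l) w × R₁ (I₁.lrank l s) (I₁.lrank l w)) →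
                    s ∈ assigneesL I₂ M l
                    ⊎ ∃[ w ] (Worst (I₂.lrank l) (assigneesL I₂ M l) w × R₂ (I₂.lrank l s) (I₂.lrank l w))
          member-or-beaten (inj₁ s∈) = inj₁ (subst (s ∈_) (assigneesL≡ l) s∈)
          member-or-beaten (inj₂ (w , (w∈ , _) , Rw)) with w ≟F s
          ... | yes refl = inj₁ (subst (s ∈_) (assigneesL≡ l) w∈)
          ... | no w≢s   = inj₂ (some-worst (λ x x∈ → subst (x ∈_) (sym (assigneesL≡ l)) x∈)
                                  w (subst (w ∈_) (assigneesL≡ l) w∈) w≢s Rw)
      transfer (inj₂ (inj₂ (p-full , w , (w∈ , _) , Rw))) =
        inj₂ (inj₂ (trans p-full (pcap≡ p) ,
                    some-worst (λ x x∈ → assigneesP⊆assigneesL I₁ M x∈) w w∈ w≢s Rw))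
        where
          w≢s : w ≢ s
          w≢s refl = unassigned (assigneesP⁻ I₁ M w∈)

  blocking : ∀ {R₁ R₂ : ℕ → ℕ → Set} {s p} → (∀ {a} → UpClosed (R₂ a)) →
    StudentComparisons R₁ R₂ s p →
    LecturerComparisons R₁ R₂ s p →
    Blocking I₁ M R₁ s p → Blocking I₂ M R₂ s p
  blocking {R₁} {R₂} {s} {p} up student lecturer (acceptable , unassigned , s-side , l-side) =
    subst T (acc≡ s p) acceptable , unassigned , student-side s-side ,
    subst (LecturerSideAt I₂ M R₂ s p) (offer≡ p) (lecturer-side {R₁} {R₂} unassigned up lecturer l-side)
    where
      student-side : StudentSide I₁ M R₁ s p → StudentSide I₂ M R₂ s p
      student-side (inj₁ Ms≡nothing)    = inj₁ Ms≡nothing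
      student-side (inj₂ (q , Ms≡q , R)) = inj₂ (q , Ms≡q , student q Ms≡q R)

module _ {n₁ n₂ n₃ : ℕ} (I : Instance n₁ n₂ n₃) (M : Assign n₁ n₂) (matching : IsMatching I M) where
  private
    module I = Instance I

  assignee-in-list : ∀ {w l} → w ∈ assigneesL I M l → InList I l w
  assignee-in-list w∈ with assigneesL⁻ I M w∈
  ... | q , Mw≡q , offer-q≡l = q , offer-q≡l , proj₁ matching _ q Mw≡q

  tie-broken-blocking⇒weakly-blocking : ∀ J {s p} → BreaksTies I J →
    Blocking J M _<_ s p → Blocking I M _≤_ s p
  tie-broken-blocking⇒weakly-blocking J {s} {p}
      (acc≡ , offer≡ , pcap≡ , lcap≡ , _ , srank-refines , lrank-refines)
      b@(acceptable , _) =
    Transfer.blocking frame M {_<_} {_≤_} ≤-trans student lecturer b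
    where
      module J = Instance J

      frame : SameFrame J I
      frame = same-frame (λ s p → sym (acc≡ s p)) (λ p → sym (offer≡ p))
                         (λ p → sym (pcap≡ p)) (λ l → sym (lcap≡ l))

      acceptableI : Acceptable I s p
      acceptableI = subst T (sym (acc≡ s p)) acceptable

      student : Transfer.StudentComparisons frame M _<_ _≤_ s p
      student q Ms≡q = refinement-reflects (I.srank s) (J.srank s) (srank-refines s)
                         acceptableI (proj₁ matching s q Ms≡q)

      lecturer : Transfer.LecturerComparisons frame M _<_ _≤_ s p
      lecturer w w∈ _ = refinement-reflects (I.lrank l) (J.lrank l) (lrank-refines l)
                          (p , offer≡ p , acceptableI)
                          (assignee-in-list (subst (w ∈_) (Transfer.assigneesL≡ frame M l) w∈))
        where
          l : Fin n₃
          l = J.offer p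

module _ {n₁ n₂ n₃ : ℕ} (I : Instance n₁ n₂ n₃) where
  private
    module I = Instance I

  favouring : Fin n₁ → Fin n₂ → Instance n₁ n₂ n₃
  favouring s₀ p₀ = record I
    { srank = λ s → refine (I.srank s) (favour p₀)
    ; lrank = λ l → refine (I.lrank l) (favour s₀)
    }

  -- Refining by injective keys keeps every strict preference and makes all
  -- lists strict.
  favouring-breaks-ties : ∀ s₀ p₀ → BreaksTies I (favouring s₀ p₀)
  favouring-breaks-ties s₀ p₀ =
    (λ _ _ → refl) , (λ _ → refl) , (λ _ → refl) , (λ _ → refl) ,
    ( (λ s p q _ _ p≢q eq → p≢q (refine-injective (I.srank s) (favour p₀) (favour-injective p₀) eq))
    , (λ l x y _ _ x≢y eq → x≢y (refine-injective (I.lrank l) (favour s₀) (favour-injective s₀) eq)) ) ,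
    (λ s _ _ _ _ → refine-< (I.srank s) (favour p₀)) ,
    (λ l _ _ _ _ → refine-< (I.lrank l) (favour s₀))

  weakly-blocking⇒favoured-blocking : ∀ (M : Assign n₁ n₂) {s p} →
    Blocking I M _≤_ s p → Blocking (favouring s p) M _<_ s p
  weakly-blocking⇒favoured-blocking M {s} {p} b@(_ , unassigned , _) =
    Transfer.blocking frame M {_≤_} {_<_} <-≤-trans student lecturer b
    where
      frame : SameFrame I (favouring s p)
      frame = same-frame (λ _ _ → refl) (λ _ → refl) (λ _ → refl) (λ _ → refl)

      student : Transfer.StudentComparisons frame M _≤_ _<_ s p
      student q Ms≡q ranks≤ = refine-key (I.srank s) (favour p) ranks≤ (favour-first p q≢p)
        where
          q≢p : q ≢ p
          q≢p refl = unassigned Ms≡q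

      lecturer : Transfer.LecturerComparisons frame M _≤_ _<_ s p
      lecturer w _ w≢s ranks≤ = refine-key (I.lrank (I.offer p)) (favour s) ranks≤ (favour-first s w≢s)

proposition1 : {n₁ n₂ n₃ : ℕ} (I : Instance n₁ n₂ n₃) (M : Assign n₁ n₂) →
    IsMatching I M →
    (SuperStable I M ⇔ ((J : Instance n₁ n₂ n₃) → BreaksTies I J → Stable J M))
proposition1 I M matching = mk⇔
  (λ super-stable J breaks s p blocking →
     super-stable s p (tie-broken-blocking⇒weakly-blocking I M matching J breaks blocking))
  (λ stable-in-all s p blocking →
     stable-in-all (favouring I s p) (favouring-breaks-ties I s p) s p
                   (weakly-blocking⇒favoured-blocking I M blocking))
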